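{- Let $\mathcal{NR}\subseteq\mathbb{F}_2^{16}$ be the Nordstrom-Robinson code and $\mathcal{R}\subseteq\mathcal{NR}$ the Reed-Muller subcode, as constructed below. Let $\mathrm{Aut}(\mathcal{NR})$ be the setwise stabiliser of $\mathcal{NR}$ in $\mathrm{Aut}(\Gamma_{16})$, and let $\mu:\mathrm{Aut}(\mathcal{NR})\to S_{16}$ be the homomorphism sending $g\sigma$ (with $g$ a translation and $\sigma$ a coordinate permutation) to $\sigma$. Then the kernel of $\mu$ equals $T_{\mathcal{R}}=\{\alpha\mapsto\alpha+\beta:\beta\in\mathcal{R}\}$, the group of translations of $\mathbb{F}_2^{16}$ by elements of $\mathcal{R}$.
   Context: $\mathrm{Aut}(\Gamma_{16})$ is the group of maps $\mathbb{F}_2^{16}\to\mathbb{F}_2^{16}$ of the form $\alpha\mapsto(\alpha+\beta)$ followed by a permutation of coordinates; every element is uniquely $g\sigma$ with $g$ a translation and $\sigma\in S_{16}$ a coordinate permutation. Construction: let $\mathcal{G}\subseteq\mathbb{F}_2^{24}$ be the extended binary Golay code (a $[24,12,8]$ linear code) with coordinates chosen so that $(1^8,0^{16})\in\mathcal{G}$. Let $J^*=\{1,\dots,8\}$, $J=\{9,\dots,24\}$. Let $\mathcal{D}$ be the codewords of $\mathcal{G}$ whose support is disjoint from $J^*$, and for $i=1,\dots,7$ let $\mathcal{D}^i$ be the codewords of $\mathcal{G}$ whose support meets $J^*$ exactly in $\{i,8\}$. $\mathcal{NR}$ is the set of restrictions to the coordinates $J$ of the words of $\mathcal{D}\cup\mathcal{D}^1\cup\dots\cup\mathcal{D}^7$,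 and $\mathcal{R}$ is the set of restrictions to $J$ of the words of $\mathcal{D}$ (it is the Reed-Muller code $R(1,4)$). -}

module Defs where

open import Data.Bool using (Bool; true; false; _xor_)
open import Data.Nat using (ℕ)
open import Data.Fin using (Fin; inject₁; fromℕ)
open import Data.Vec using (Vec; []; _∷_; replicate; zipWith; take; drop; lookup; tabulate; foldr)
open import Data.Product using (Σ; ∃; ∃-syntax; _×_; _,_)
open import Data.Sum using (_⊎_)
open import Function.Bundles using (_↔_; Inverse)
open import Relation.Binary.PropositionalEquality using (_≡_)
open import Relation.Nullary using (yes; no)
import Data.Fin

-- Vectors over F₂ are represented as Vec Bool n (true = 1, false = 0);
-- addition in F₂ is xor.
F₂^ : ℕ → Set
F₂^ n = Vec Bool n

_⊕_ : {n : ℕ} → F₂^ n → F₂^ n → F₂^ n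
_⊕_ = zipWith _xor_

infixl 6 _⊕_

zeros : (n : ℕ) → F₂^ n
zeros n = replicate n false

private
  1# 0# : Bool
  1# = true
  0# = false

-- A generator matrix (12 rows) of the extended binary Golay code [24,12,8],
-- with coordinates chosen so that (1^8,0^16) is a codeword.
-- (Obtained from the extended quadratic residue code of length 24,
--  with coordinates permuted to move one octad to positions 1..8.)
golayGen : Vec (F₂^ 24) 12
golayGen =
      (0# ∷ 1# ∷ 0# ∷ 1# ∷ 1# ∷ 0# ∷ 0# ∷ 1# ∷ 1# ∷ 1# ∷ 1# ∷ 0# ∷ 1# ∷ 0# ∷ 1# ∷ 1# ∷ 0# ∷ 0# ∷ 1# ∷ 0# ∷ 1# ∷ 0# ∷ 0# ∷ 0# ∷ [])
  ∷   (0# ∷ 1# ∷ 1# ∷ 0# ∷ 0# ∷ 1# ∷ 0# ∷ 1# ∷ 0# ∷ 1# ∷ 1# ∷ 1# ∷ 1# ∷ 0# ∷ 0# ∷ 1# ∷ 1# ∷ 0# ∷ 0# ∷ 1# ∷ 0# ∷ 1# ∷ 0# ∷ 0# ∷ [])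
  ∷   (0# ∷ 1# ∷ 1# ∷ 1# ∷ 1# ∷ 1# ∷ 0# ∷ 1# ∷ 0# ∷ 0# ∷ 1# ∷ 0# ∷ 0# ∷ 1# ∷ 0# ∷ 0# ∷ 1# ∷ 1# ∷ 0# ∷ 0# ∷ 1# ∷ 0# ∷ 1# ∷ 0# ∷ [])
  ∷   (0# ∷ 1# ∷ 1# ∷ 1# ∷ 0# ∷ 0# ∷ 0# ∷ 1# ∷ 0# ∷ 0# ∷ 0# ∷ 1# ∷ 1# ∷ 1# ∷ 1# ∷ 0# ∷ 0# ∷ 1# ∷ 1# ∷ 0# ∷ 0# ∷ 1# ∷ 0# ∷ 1# ∷ [])
  ∷   (0# ∷ 0# ∷ 1# ∷ 1# ∷ 1# ∷ 1# ∷ 1# ∷ 1# ∷ 0# ∷ 0# ∷ 0# ∷ 1# ∷ 0# ∷ 0# ∷ 1# ∷ 1# ∷ 0# ∷ 0# ∷ 1# ∷ 1# ∷ 0# ∷ 0# ∷ 1# ∷ 0# ∷ [])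
  ∷   (1# ∷ 0# ∷ 0# ∷ 1# ∷ 1# ∷ 0# ∷ 0# ∷ 1# ∷ 0# ∷ 0# ∷ 0# ∷ 1# ∷ 1# ∷ 1# ∷ 0# ∷ 1# ∷ 1# ∷ 0# ∷ 0# ∷ 1# ∷ 1# ∷ 0# ∷ 0# ∷ 1# ∷ [])
  ∷   (0# ∷ 0# ∷ 0# ∷ 0# ∷ 1# ∷ 1# ∷ 0# ∷ 0# ∷ 0# ∷ 0# ∷ 0# ∷ 1# ∷ 1# ∷ 0# ∷ 1# ∷ 1# ∷ 0# ∷ 1# ∷ 0# ∷ 0# ∷ 0# ∷ 0# ∷ 1# ∷ 0# ∷ [])
  ∷   (0# ∷ 0# ∷ 0# ∷ 0# ∷ 1# ∷ 1# ∷ 0# ∷ 0# ∷ 0# ∷ 0# ∷ 0# ∷ 0# ∷ 1# ∷ 1# ∷ 0# ∷ 1# ∷ 1# ∷ 0# ∷ 1# ∷ 0# ∷ 0# ∷ 0# ∷ 0# ∷ 1# ∷ [])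
  ∷   (0# ∷ 0# ∷ 0# ∷ 0# ∷ 0# ∷ 1# ∷ 1# ∷ 0# ∷ 0# ∷ 0# ∷ 0# ∷ 0# ∷ 1# ∷ 1# ∷ 1# ∷ 0# ∷ 1# ∷ 1# ∷ 0# ∷ 1# ∷ 0# ∷ 0# ∷ 0# ∷ 0# ∷ [])
  ∷   (0# ∷ 0# ∷ 0# ∷ 1# ∷ 0# ∷ 0# ∷ 0# ∷ 1# ∷ 0# ∷ 0# ∷ 0# ∷ 0# ∷ 0# ∷ 0# ∷ 0# ∷ 1# ∷ 1# ∷ 0# ∷ 1# ∷ 1# ∷ 0# ∷ 0# ∷ 1# ∷ 1# ∷ [])
  ∷   (0# ∷ 0# ∷ 0# ∷ 0# ∷ 0# ∷ 0# ∷ 1# ∷ 1# ∷ 0# ∷ 0# ∷ 0# ∷ 0# ∷ 0# ∷ 1# ∷ 1# ∷ 0# ∷ 0# ∷ 0# ∷ 1# ∷ 1# ∷ 1# ∷ 0# ∷ 1# ∷ 0# ∷ [])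
  ∷   (0# ∷ 0# ∷ 0# ∷ 0# ∷ 0# ∷ 1# ∷ 1# ∷ 0# ∷ 0# ∷ 0# ∷ 0# ∷ 0# ∷ 0# ∷ 0# ∷ 1# ∷ 0# ∷ 0# ∷ 1# ∷ 0# ∷ 0# ∷ 1# ∷ 1# ∷ 1# ∷ 1# ∷ [])
  ∷ []

lincomb : {m n : ℕ} → Vec (F₂^ n) m → F₂^ m → F₂^ n
lincomb {n = n} [] [] = zeros n
lincomb (r ∷ rs) (true ∷ cs) = r ⊕ lincomb rs cs
lincomb (r ∷ rs) (false ∷ cs) = lincomb rs cs

_∈𝒢 : F₂^ 24 → Set
c ∈𝒢 = ∃[ coeffs ] lincomb golayGen coeffs ≡ c

-- Coordinates J* = {1,…,8} are the first 8, J = {9,…,24} the last 16.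
restrictJ : F₂^ 24 → F₂^ 16
restrictJ c = drop 8 c

restrictJ* : F₂^ 24 → F₂^ 8
restrictJ* c = take 8 c

-- Indicator vector (in F₂^8) of the set {i,8}, for i ∈ {1,…,7}
-- (i : Fin 7 is 0-indexed, so coordinate i+1; coordinate 8 is fromℕ 7).
pair8 : Fin 7 → F₂^ 8
pair8 i = tabulate (λ j → indic (inject₁ i) j xor indic (fromℕ 7) j)
  where
  indic : Fin 8 → Fin 8 → Bool
  indic a b with a Data.Fin.≟ b
  ... | yes _ = true
  ... | no _ = false

_∈𝒟 : F₂^ 24 → Set
c ∈𝒟 = (c ∈𝒢) × (restrictJ* c ≡ zeros 8)

_∈𝒟^_ : F₂^ 24 → Fin 7 → Set
c ∈𝒟^ i = (c ∈𝒢) × (restrictJ* c ≡ pair8 i)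

_∈𝒩ℛ : F₂^ 16 → Set
α ∈𝒩ℛ = ∃[ c ] ((c ∈𝒟 ⊎ ∃[ i ] (c ∈𝒟^ i)) × (restrictJ c ≡ α))

_∈ℛ : F₂^ 16 → Set
α ∈ℛ = ∃[ c ] ((c ∈𝒟) × (restrictJ c ≡ α))

Perm16 : Set
Perm16 = Fin 16 ↔ Fin 16

permute : Perm16 → F₂^ 16 → F₂^ 16
permute σ α = tabulate (λ i → lookup α (Inverse.from σ i))

-- An element of Aut(Γ₁₆), written uniquely as g σ with g the translation
-- by β: the map α ↦ σ·(α + β).
record AutΓ16 : Set where
  constructor _·_
  field
    β : F₂^ 16
    σ : Perm16

open AutΓ16 public

apply : AutΓ16 → F₂^ 16 → F₂^ 16
apply (β · σ) α = permute σ (α ⊕ β)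

_∈Aut𝒩ℛ : AutΓ16 → Set
f ∈Aut𝒩ℛ = (∀ α → α ∈𝒩ℛ → apply f α ∈𝒩ℛ)
         × (∀ γ → γ ∈𝒩ℛ → ∃[ α ] ((α ∈𝒩ℛ) × (apply f α ≡ γ)))

μ : AutΓ16 → Perm16
μ f = σ f

IsIdPerm : Perm16 → Set
IsIdPerm σ = ∀ i → Inverse.to σ i ≡ i

_∈ker-μ : AutΓ16 → Set
f ∈ker-μ = (f ∈Aut𝒩ℛ) × IsIdPerm (μ f)

_∈Tℛ : AutΓ16 → Set
f ∈Tℛ = (β f ∈ℛ) × IsIdPerm (σ f)

module Submission where

-- An element of the kernel has trivial permutation part, so it is the
-- translation α ↦ α + β, and it lies in Aut(𝒩ℛ) exactly when 𝒩ℛ + β = 𝒩ℛ.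
-- Hence the theorem says: 𝒩ℛ + β ⊆ 𝒩ℛ  iff  β ∈ ℛ.
--
-- (⇐) A word of 𝒟 vanishes on J*, so adding it to a word of 𝒟 ∪ ⋃ᵢ 𝒟ⁱ
--     keeps the J*-pattern (0 or {i,8}); by linearity of 𝒢 the sum is again
--     in 𝒟 ∪ ⋃ᵢ 𝒟ⁱ.
-- (⇒) β = β + 0 ∈ 𝒩ℛ, so β is the J-part of some c ∈ 𝒟 ∪ ⋃ᵢ 𝒟ⁱ.  If c ∈ 𝒟ⁱ,
--     pick w ∈ 𝒟ʲ with j ≠ i; then w|_J + β = c'|_J for some c' ∈ 𝒟 ∪ ⋃ₖ 𝒟ᵏ,
--     so w and c + c' are Golay codewords agreeing on J.  Their difference
--     vanishes on J, hence (minimum distance 8) equals 0 or the octad 1⁸ on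
--     J*; but on J* it is {i,8} + {j,8} + (0 or {k,8}), of weight 2 or 4.

open import Defs
open import Data.Bool using (Bool; true; false; _xor_)
open import Data.Bool.Properties using (xor-same; xor-comm; xor-assoc) renaming (_≟_ to _≟ᵇ_)
open import Data.Fin using (Fin; zero; suc)
open import Data.Fin.Properties using (all?)
open import Data.Fin.Subset.Properties using (anySubset?)
open import Data.Vec using (Vec; []; _∷_; replicate; lookup; tabulate)
open import Data.Vec.Properties
  using (zipWith-assoc; zipWith-comm; zipWith-identityˡ; take-zipWith; drop-zipWith; tabulate-cong; tabulate∘lookup; ≡-dec)
open import Data.Product using (∃; ∃-syntax; _×_; _,_; proj₁; proj₂)
open import Data.Sum using (_⊎_; inj₁; inj₂)
open import Data.Unit using (tt)
open import Function.Bundles using (_⇔_; Inverse; mk⇔)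
open import Relation.Nullary using (Dec; yes; no; ¬_; contradiction)
open import Relation.Nullary.Decidable using (toWitness; decidable-stable; ¬?; _⊎-dec_; _×-dec_; _→-dec_)
open import Relation.Unary using (Decidable)
open import Relation.Binary.PropositionalEquality

⊕-assoc : ∀ {n} (x y z : F₂^ n) → (x ⊕ y) ⊕ z ≡ x ⊕ (y ⊕ z)
⊕-assoc = zipWith-assoc xor-assoc

⊕-comm : ∀ {n} (x y : F₂^ n) → x ⊕ y ≡ y ⊕ x
⊕-comm = zipWith-comm xor-comm

⊕-identityˡ : ∀ {n} (x : F₂^ n) → zeros n ⊕ x ≡ x
⊕-identityˡ = zipWith-identityˡ (λ _ → refl)

⊕-identityʳ : ∀ {n} (x : F₂^ n) → x ⊕ zeros n ≡ x
⊕-identityʳ x = trans (⊕-comm x _) (⊕-identityˡ x)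

⊕-self : ∀ {n} (x : F₂^ n) → x ⊕ x ≡ zeros n
⊕-self []      = refl
⊕-self (a ∷ x) = cong₂ _∷_ (xor-same a) (⊕-self x)

⊕-cancelʳ : ∀ {n} (x y : F₂^ n) → (x ⊕ y) ⊕ y ≡ x
⊕-cancelʳ x y = begin
  (x ⊕ y) ⊕ y   ≡⟨ ⊕-assoc x y y ⟩
  x ⊕ (y ⊕ y)   ≡⟨ cong (x ⊕_) (⊕-self y) ⟩
  x ⊕ zeros _   ≡⟨ ⊕-identityʳ x ⟩
  x             ∎
  where open ≡-Reasoning

⊕-interchange : ∀ {n} (x y z w : F₂^ n) → (x ⊕ y) ⊕ (z ⊕ w) ≡ (x ⊕ z) ⊕ (y ⊕ w)
⊕-interchange x y z w = begin
  (x ⊕ y) ⊕ (z ⊕ w)   ≡⟨ ⊕-assoc x y (z ⊕ w) ⟩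
  x ⊕ (y ⊕ (z ⊕ w))   ≡⟨ cong (x ⊕_) (sym (⊕-assoc y z w)) ⟩
  x ⊕ ((y ⊕ z) ⊕ w)   ≡⟨ cong (λ t → x ⊕ (t ⊕ w)) (⊕-comm y z) ⟩
  x ⊕ ((z ⊕ y) ⊕ w)   ≡⟨ cong (x ⊕_) (⊕-assoc z y w) ⟩
  x ⊕ (z ⊕ (y ⊕ w))   ≡⟨ sym (⊕-assoc x z (y ⊕ w)) ⟩
  (x ⊕ z) ⊕ (y ⊕ w)   ∎
  where open ≡-Reasoning

restrictJ-⊕ : ∀ (x y : F₂^ 24) → restrictJ (x ⊕ y) ≡ restrictJ x ⊕ restrictJ y
restrictJ-⊕ = drop-zipWith {m = 8} _xor_

restrictJ*-⊕ : ∀ (x y : F₂^ 24) → restrictJ* (x ⊕ y) ≡ restrictJ* x ⊕ restrictJ* y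
restrictJ*-⊕ = take-zipWith {m = 8} _xor_

scale : ∀ {n} → Bool → F₂^ n → F₂^ n
scale true  r = r
scale false r = zeros _

scale-xor : ∀ {n} (a b : Bool) (r : F₂^ n) → scale (a xor b) r ≡ scale a r ⊕ scale b r
scale-xor true  true  r = sym (⊕-self r)
scale-xor true  false r = sym (⊕-identityʳ r)
scale-xor false b     r = sym (⊕-identityˡ (scale b r))

lincomb-∷ : ∀ {m n} (r : F₂^ n) (rs : Vec (F₂^ n) m) (b : Bool) (cs : F₂^ m) →
            lincomb (r ∷ rs) (b ∷ cs) ≡ scale b r ⊕ lincomb rs cs
lincomb-∷ r rs true  cs = refl
lincomb-∷ r rs false cs = sym (⊕-identityˡ (lincomb rs cs))

lincomb-⊕ : ∀ {m n} (rs : Vec (F₂^ n) m) (xs ys : F₂^ m) →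
            lincomb rs (xs ⊕ ys) ≡ lincomb rs xs ⊕ lincomb rs ys
lincomb-⊕ []       []       []       = sym (⊕-self _)
lincomb-⊕ (r ∷ rs) (a ∷ xs) (b ∷ ys) = begin
  lincomb (r ∷ rs) ((a xor b) ∷ (xs ⊕ ys))
    ≡⟨ lincomb-∷ r rs (a xor b) (xs ⊕ ys) ⟩
  scale (a xor b) r ⊕ lincomb rs (xs ⊕ ys)
    ≡⟨ cong₂ _⊕_ (scale-xor a b r) (lincomb-⊕ rs xs ys) ⟩
  (scale a r ⊕ scale b r) ⊕ (lincomb rs xs ⊕ lincomb rs ys)
    ≡⟨ ⊕-interchange (scale a r) (scale b r) _ _ ⟩
  (scale a r ⊕ lincomb rs xs) ⊕ (scale b r ⊕ lincomb rs ys)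
    ≡⟨ sym (cong₂ _⊕_ (lincomb-∷ r rs a xs) (lincomb-∷ r rs b ys)) ⟩
  lincomb (r ∷ rs) (a ∷ xs) ⊕ lincomb (r ∷ rs) (b ∷ ys)
    ∎
  where open ≡-Reasoning

𝒢-closed : ∀ {c d} → c ∈𝒢 → d ∈𝒢 → (c ⊕ d) ∈𝒢
𝒢-closed (xs , refl) (ys , refl) = xs ⊕ ys , lincomb-⊕ golayGen xs ys

-- A property of all vectors of F₂ⁿ is decidable (by exhausting the 2ⁿ
-- vectors); this is how the facts about the Golay code below are checked.
∀-vector? : ∀ {n} {P : F₂^ n → Set} → Decidable P → Dec (∀ v → P v)
∀-vector? P? with anySubset? (λ v → ¬? (P? v))
... | yes (v , ¬Pv) = no (λ all → ¬Pv (all v))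
... | no ∄¬P        = yes (λ v → decidable-stable (P? v) (λ ¬Pv → ∄¬P (v , ¬Pv)))

-- The J*-parts a Golay codeword vanishing on J can have: 0 or the octad 1⁸.
ZeroOrOctad : F₂^ 8 → Set
ZeroOrOctad t = (t ≡ zeros 8) ⊎ (t ≡ replicate 8 true)

zeroOrOctad? : Decidable ZeroOrOctad
zeroOrOctad? t = ≡-dec _≟ᵇ_ t (zeros 8) ⊎-dec ≡-dec _≟ᵇ_ t (replicate 8 true)

-- A Golay codeword vanishing on J is 0 or the octad (1⁸,0¹⁶): this is the
-- minimum distance 8 of 𝒢, checked over all 2¹² codewords.
golay-J-vanishing : ∀ {c} → c ∈𝒢 → restrictJ c ≡ zeros 16 → ZeroOrOctad (restrictJ* c)
golay-J-vanishing (cs , refl) = toWitness {a? = ∀-vector? λ cs →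
  ≡-dec _≟ᵇ_ (restrictJ (lincomb golayGen cs)) (zeros 16)
    →-dec zeroOrOctad? (restrictJ* (lincomb golayGen cs))} tt cs

golay-agree-on-J : ∀ {c d} → c ∈𝒢 → d ∈𝒢 → restrictJ c ≡ restrictJ d →
                   ZeroOrOctad (restrictJ* c ⊕ restrictJ* d)
golay-agree-on-J {c} {d} c∈𝒢 d∈𝒢 cJ≡dJ =
  subst ZeroOrOctad (restrictJ*-⊕ c d) (golay-J-vanishing (𝒢-closed c∈𝒢 d∈𝒢) vanishes)
  where
  vanishes : restrictJ (c ⊕ d) ≡ zeros 16
  vanishes = trans (restrictJ-⊕ c d) (trans (cong (_⊕ restrictJ d) cJ≡dJ) (⊕-self (restrictJ d)))

-- Every 𝒟ʲ is nonempty: coefficient vectors of a codeword meeting J* in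
-- {j,8}, for each j (found by search, verified by computation).
𝒟^-coefficients : Fin 7 → F₂^ 12
𝒟^-coefficients zero = true ∷ true ∷ true ∷ true ∷ true ∷ true ∷ true ∷ true ∷ true ∷ true ∷ false ∷ false ∷ []
𝒟^-coefficients (suc zero) = true ∷ true ∷ true ∷ false ∷ false ∷ false ∷ true ∷ true ∷ true ∷ false ∷ false ∷ true ∷ []
𝒟^-coefficients (suc (suc zero)) = true ∷ true ∷ true ∷ true ∷ false ∷ false ∷ true ∷ true ∷ true ∷ true ∷ false ∷ true ∷ []
𝒟^-coefficients (suc (suc (suc zero))) = true ∷ true ∷ true ∷ true ∷ true ∷ false ∷ true ∷ false ∷ true ∷ true ∷ true ∷ true ∷ []
𝒟^-coefficients (suc (suc (suc (suc zero)))) = true ∷ true ∷ true ∷ true ∷ true ∷ false ∷ true ∷ true ∷ true ∷ false ∷ false ∷ false ∷ []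
𝒟^-coefficients (suc (suc (suc (suc (suc zero))))) = true ∷ true ∷ true ∷ true ∷ true ∷ false ∷ true ∷ false ∷ true ∷ false ∷ false ∷ false ∷ []
𝒟^-coefficients (suc (suc (suc (suc (suc (suc zero)))))) = true ∷ true ∷ true ∷ true ∷ true ∷ false ∷ true ∷ false ∷ true ∷ false ∷ false ∷ true ∷ []

𝒟^-nonempty : ∀ j → ∃[ c ] (c ∈𝒟^ j)
𝒟^-nonempty j = lincomb golayGen (𝒟^-coefficients j) , (𝒟^-coefficients j , refl) , meets-J*-in-pair j
  where
  meets-J*-in-pair : ∀ i → restrictJ* (lincomb golayGen (𝒟^-coefficients i)) ≡ pair8 i
  meets-J*-in-pair = toWitness {a? = all? λ i →
    ≡-dec _≟ᵇ_ (restrictJ* (lincomb golayGen (𝒟^-coefficients i))) (pair8 i)} tt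

partner : Fin 7 → Fin 7
partner zero    = suc zero
partner (suc _) = zero

-- The J*-parts of the words of 𝒟 ∪ 𝒟¹ ∪ … ∪ 𝒟⁷: 0 or {i,8}.
Pattern : F₂^ 8 → Set
Pattern t = (t ≡ zeros 8) ⊎ ∃[ i ] (t ≡ pair8 i)

-- With j = partner i ≠ i, the vectors {i,8} + {j,8} + 0 and
-- {i,8} + {j,8} + {k,8} have weight 2 or 4, so are neither 0 nor 1⁸;
-- checked over all i and k.
partner-sums-nontrivial : ∀ i → ¬ ZeroOrOctad (pair8 (partner i) ⊕ (zeros 8 ⊕ pair8 i))
                                × (∀ k → ¬ ZeroOrOctad (pair8 (partner i) ⊕ (pair8 k ⊕ pair8 i)))
partner-sums-nontrivial = toWitness {a? = all? λ i →
  ¬? (zeroOrOctad? (pair8 (partner i) ⊕ (zeros 8 ⊕ pair8 i)))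
    ×-dec all? λ k → ¬? (zeroOrOctad? (pair8 (partner i) ⊕ (pair8 k ⊕ pair8 i)))} tt

pattern-sum-nontrivial : ∀ {t} i → Pattern t → ¬ ZeroOrOctad (pair8 (partner i) ⊕ (t ⊕ pair8 i))
pattern-sum-nontrivial i (inj₁ refl)       = proj₁ (partner-sums-nontrivial i)
pattern-sum-nontrivial i (inj₂ (k , refl)) = proj₂ (partner-sums-nontrivial i) k

_∈𝒟∪𝒟^ : F₂^ 24 → Set
c ∈𝒟∪𝒟^ = c ∈𝒟 ⊎ ∃[ i ] (c ∈𝒟^ i)

∈𝒟∪𝒟^⇒pattern : ∀ {c} → c ∈𝒟∪𝒟^ → (c ∈𝒢) × Pattern (restrictJ* c)
∈𝒟∪𝒟^⇒pattern (inj₁ (c∈𝒢 , c*≡0))       = c∈𝒢 , inj₁ c*≡0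
∈𝒟∪𝒟^⇒pattern (inj₂ (i , c∈𝒢 , c*≡pair)) = c∈𝒢 , inj₂ (i , c*≡pair)

pattern⇒∈𝒟∪𝒟^ : ∀ {c} → c ∈𝒢 → Pattern (restrictJ* c) → c ∈𝒟∪𝒟^
pattern⇒∈𝒟∪𝒟^ c∈𝒢 (inj₁ c*≡0)         = inj₁ (c∈𝒢 , c*≡0)
pattern⇒∈𝒟∪𝒟^ c∈𝒢 (inj₂ (i , c*≡pair)) = inj₂ (i , c∈𝒢 , c*≡pair)

zeros∈𝒩ℛ : zeros 16 ∈𝒩ℛ
zeros∈𝒩ℛ = zeros 24 , inj₁ ((zeros 12 , refl) , refl) , refl

𝒩ℛ+ℛ⊆𝒩ℛ : ∀ {α β} → β ∈ℛ → α ∈𝒩ℛ → (α ⊕ β) ∈𝒩ℛ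
𝒩ℛ+ℛ⊆𝒩ℛ (d , (d∈𝒢 , d*≡0) , dJ≡β) (c , c∈𝒟∪𝒟^ , cJ≡α) with ∈𝒟∪𝒟^⇒pattern c∈𝒟∪𝒟^
... | c∈𝒢 , pat = c ⊕ d
                , pattern⇒∈𝒟∪𝒟^ (𝒢-closed c∈𝒢 d∈𝒢) (subst Pattern (sym same-on-J*) pat)
                , trans (restrictJ-⊕ c d) (cong₂ _⊕_ cJ≡α dJ≡β)
  where
  same-on-J* : restrictJ* (c ⊕ d) ≡ restrictJ* c
  same-on-J* = trans (restrictJ*-⊕ c d) (trans (cong (restrictJ* c ⊕_) d*≡0) (⊕-identityʳ _))

𝒟^-translation-breaks-𝒩ℛ : ∀ {c i} → c ∈𝒟^ i →
                           ¬ (∀ α → α ∈𝒩ℛ → (α ⊕ restrictJ c) ∈𝒩ℛ)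
𝒟^-translation-breaks-𝒩ℛ {c} {i} (c∈𝒢 , c*≡pair) invariant
  with 𝒟^-nonempty (partner i)
... | w , w∈𝒢 , w*≡pair with invariant (restrictJ w) (w , inj₂ (partner i , w∈𝒢 , w*≡pair) , refl)
... | c' , c'∈𝒟∪𝒟^ , c'J≡wJ+cJ with ∈𝒟∪𝒟^⇒pattern c'∈𝒟∪𝒟^
... | c'∈𝒢 , pat = pattern-sum-nontrivial i pat
                      (subst ZeroOrOctad J*-parts (golay-agree-on-J w∈𝒢 (𝒢-closed c'∈𝒢 c∈𝒢) same-on-J))
  where
  same-on-J : restrictJ w ≡ restrictJ (c' ⊕ c)
  same-on-J = sym (begin
    restrictJ (c' ⊕ c)                         ≡⟨ restrictJ-⊕ c' c ⟩
    restrictJ c' ⊕ restrictJ c                 ≡⟨ cong (_⊕ restrictJ c) c'J≡wJ+cJ ⟩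
    (restrictJ w ⊕ restrictJ c) ⊕ restrictJ c  ≡⟨ ⊕-cancelʳ (restrictJ w) (restrictJ c) ⟩
    restrictJ w                                ∎)
    where open ≡-Reasoning
  J*-parts : restrictJ* w ⊕ restrictJ* (c' ⊕ c) ≡ pair8 (partner i) ⊕ (restrictJ* c' ⊕ pair8 i)
  J*-parts = cong₂ _⊕_ w*≡pair (trans (restrictJ*-⊕ c' c) (cong (restrictJ* c' ⊕_) c*≡pair))

𝒩ℛ+β⊆𝒩ℛ⇒β∈ℛ : ∀ {β} → (∀ α → α ∈𝒩ℛ → (α ⊕ β) ∈𝒩ℛ) → β ∈ℛ
𝒩ℛ+β⊆𝒩ℛ⇒β∈ℛ {β} invariant with subst _∈𝒩ℛ (⊕-identityˡ β) (invariant (zeros 16) zeros∈𝒩ℛ)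
... | c , inj₁ c∈𝒟 , cJ≡β      = c , c∈𝒟 , cJ≡β
... | c , inj₂ (i , c∈𝒟^) , refl = contradiction invariant (𝒟^-translation-breaks-𝒩ℛ {i = i} c∈𝒟^)

permute-id : ∀ σ → IsIdPerm σ → ∀ α → permute σ α ≡ α
permute-id σ idσ α = trans (tabulate-cong (λ i → cong (lookup α) (from-id i))) (tabulate∘lookup α)
  where
  from-id : ∀ i → Inverse.from σ i ≡ i
  from-id i = trans (sym (idσ (Inverse.from σ i))) (Inverse.strictlyInverseˡ σ i)

lemma3p1 : ∀ (f : AutΓ16) → (f ∈ker-μ) ⇔ (f ∈Tℛ)
lemma3p1 (β · σ) = mk⇔ kernel⇒Tℛ Tℛ⇒kernel
  where
  translation : IsIdPerm σ → ∀ α → apply (β · σ) α ≡ α ⊕ β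
  translation idσ α = permute-id σ idσ (α ⊕ β)

  kernel⇒Tℛ : (β · σ) ∈ker-μ → (β · σ) ∈Tℛ
  kernel⇒Tℛ ((into , _) , idσ) =
    𝒩ℛ+β⊆𝒩ℛ⇒β∈ℛ (λ α α∈𝒩ℛ → subst _∈𝒩ℛ (translation idσ α) (into α α∈𝒩ℛ)) , idσ

  Tℛ⇒kernel : (β · σ) ∈Tℛ → (β · σ) ∈ker-μ
  Tℛ⇒kernel (β∈ℛ , idσ) = (into , onto) , idσ
    where
    into : ∀ α → α ∈𝒩ℛ → apply (β · σ) α ∈𝒩ℛ
    into α α∈𝒩ℛ = subst _∈𝒩ℛ (sym (translation idσ α)) (𝒩ℛ+ℛ⊆𝒩ℛ β∈ℛ α∈𝒩ℛ)
    onto : ∀ γ → γ ∈𝒩ℛ → ∃[ α ] ((α ∈𝒩ℛ) × (apply (β · σ) α ≡ γ))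
    onto γ γ∈𝒩ℛ = γ ⊕ β , 𝒩ℛ+ℛ⊆𝒩ℛ β∈ℛ γ∈𝒩ℛ , trans (translation idσ (γ ⊕ β)) (⊕-cancelʳ γ β)
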